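{- Let $T:\mathbb{Z}^d\to\mathbb{Z}^d$ and $\Psi:\mathbb{Z}^d\to\mathbb{Z}^t$ be linear maps. Then the Green-Tao complexity of $\Psi\circ T$ is greater than or equal to the Green-Tao complexity of $\Psi$.
   Context: A linear form on $\mathbb{Z}^d$ is a group homomorphism $\mathbb{Z}^d\to\mathbb{Z}$; every linear map $\Psi:\mathbb{Z}^d\to\mathbb{Z}^t$ is $\Psi=(\psi_1,\dots,\psi_t)$ for unique linear forms $\psi_i$. A Green-Tao partition of size $s\geq 0$ of $\Psi$ at $i$ ($1\le i\le t$) is a partition of the $t-1$ forms $\{\psi_j: j\neq i\}$ into $s+1$ classes such that $\psi_i$ does not lie in the $\mathbb{Q}$-linear span of any class. If $\psi_i$ is not a rational multiple of any other $\psi_j$ ($j\ne i$), the $i$-complexity of $\Psi$ is the least size of a Green-Tao partition of $\Psi$ at $i$; if $\psi_i$ is a rational multiple of some other $\psi_j$, the $i$-complexity is $\infty$. The Green-Tao complexity of $\Psi$ is the maximum over $1\le i\le t$ of the $i$-complexities (values in $\{0,1,2,\dots\}\cup\{\infty\}$). -}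

module Defs where

open import Data.Nat as ℕ using (ℕ; zero; suc)
open import Data.Integer as ℤ using (ℤ)
open import Data.Rational as ℚ using (ℚ; 0ℚ)
open import Data.Fin using (Fin; zero; suc)
open import Data.Product using (Σ; ∃; ∃-syntax; _×_; _,_)
open import Data.Sum using (_⊎_)
open import Relation.Binary.PropositionalEquality using (_≡_; _≢_)
open import Relation.Nullary using (¬_)

sumℤ : {n : ℕ} → (Fin n → ℤ) → ℤ
sumℤ {zero}  f = ℤ.+ 0
sumℤ {suc n} f = f zero ℤ.+ sumℤ (λ k → f (suc k))

sumℚ : {n : ℕ} → (Fin n → ℚ) → ℚ
sumℚ {zero}  f = 0ℚ
sumℚ {suc n} f = f zero ℚ.+ sumℚ (λ k → f (suc k))

-- A linear form on ℤ^d, given by its coefficient vector: x ↦ Σ_k ψ k * x k.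
LinearForm : ℕ → Set
LinearForm d = Fin d → ℤ

-- A linear map ℤ^d → ℤ^t is a t-tuple of linear forms (ψ_1,…,ψ_t).
LinearMap : ℕ → ℕ → Set
LinearMap d t = Fin t → LinearForm d

-- Composition Ψ ∘ T, where T : ℤ^d → ℤ^d is given by its rows T k (so (T x) k = Σ_l T k l * x l).
-- (ψ_i ∘ T) has coefficient at l equal to Σ_k ψ_i k * T k l.
_∘ₗ_ : {d t : ℕ} → LinearMap d t → LinearMap d d → LinearMap d t
(Ψ ∘ₗ T) i l = sumℤ (λ k → Ψ i k ℤ.* T k l)

toℚ : ℤ → ℚ
toℚ z = z ℚ./ 1

RatMultiple : {d : ℕ} → LinearForm d → LinearForm d → Set
RatMultiple ψ φ = Σ ℚ λ q → ((k : Fin _) → toℚ (ψ k) ≡ q ℚ.* toℚ (φ k))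

InSpan : {d t : ℕ} → LinearMap d t → (Fin t → Set) → LinearForm d → Set
InSpan {d} {t} Ψ P φ =
  Σ (Fin t → ℚ) λ c → (((j : Fin t) → ¬ P j → c j ≡ 0ℚ)
         × ((k : Fin d) → toℚ (φ k) ≡ sumℚ (λ j → c j ℚ.* toℚ (Ψ j k))))

-- A Green–Tao partition of size s of Ψ at i: an assignment of each j ≠ i to one of
-- s+1 classes (classes may be empty; the value at i is irrelevant) such that ψ_i does
-- not lie in the ℚ-span of any class.
GTPartition : {d t : ℕ} → LinearMap d t → Fin t → ℕ → Set
GTPartition {d} {t} Ψ i s =
  Σ (Fin t → Fin (suc s)) λ cls →
    (a : Fin (suc s)) → ¬ InSpan Ψ (λ j → (j ≢ i) × (cls j ≡ a)) (Ψ i)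

data ℕ∞ : Set where
  fin : ℕ → ℕ∞
  ∞   : ℕ∞

data _≤∞_ : ℕ∞ → ℕ∞ → Set where
  fin≤fin : {m n : ℕ} → m ℕ.≤ n → fin m ≤∞ fin n
  ≤∞-top  : {a : ℕ∞} → a ≤∞ ∞

HasMultipleAt : {d t : ℕ} → LinearMap d t → Fin t → Set
HasMultipleAt Ψ i = ∃[ j ] ((j ≢ i) × RatMultiple (Ψ i) (Ψ j))

IsIComplexity : {d t : ℕ} → LinearMap d t → Fin t → ℕ∞ → Set
IsIComplexity Ψ i ∞       = HasMultipleAt Ψ i
IsIComplexity Ψ i (fin s) =
  ¬ HasMultipleAt Ψ i × GTPartition Ψ i s
  × ((s' : ℕ) → s' ℕ.< s → ¬ GTPartition Ψ i s')

-- "The Green–Tao complexity of Ψ is c": c is the maximum of the i-complexities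
-- (equal to 0 when t = 0).
IsGTComplexity : {d t : ℕ} → LinearMap d t → ℕ∞ → Set
IsGTComplexity {d} {t} Ψ c =
  ((i : Fin t) → ∃[ cᵢ ] (IsIComplexity Ψ i cᵢ × cᵢ ≤∞ c))
  × ((c ≡ fin 0) ⊎ (∃[ i ] IsIComplexity Ψ i c))

{-# OPTIONS --safe #-}
-- Precomposing with T is ℚ-linear, so it carries each ℚ-linear relation among the
-- forms of Ψ to the same relation among the forms of Ψ ∘ T. Hence a form of Ψ that is a
-- rational multiple of another stays one after composing, and if ψᵢ ∘ T avoids the span
-- of every class of a partition, so does ψᵢ. Each i-complexity can therefore only grow,
-- and so does their maximum.
module Submission where

open import Defs
open import Data.Nat as ℕ using (ℕ; zero; suc)
import Data.Nat.Properties as ℕ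
open import Data.Integer as ℤ using (ℤ)
import Data.Integer.Properties as ℤ
open import Data.Rational using (ℚ; _+_; _*_; toℚᵘ; fromℚᵘ)
open import Data.Rational.Properties
  using (+-*-ring; *-assoc; toℚᵘ-homo-+; toℚᵘ-homo-*; toℚᵘ-fromℚᵘ; fromℚᵘ-toℚᵘ; fromℚᵘ-cong)
open import Data.Rational.Unnormalised as ℚᵘ using (mkℚᵘ; *≡*)
import Data.Rational.Unnormalised.Properties as ℚᵘ
open import Algebra.Bundles using (Ring)
open import Algebra.Properties.Semiring.Sum (Ring.semiring +-*-ring)
  using (sum; ∑-comm; *-distribˡ-sum; *-distribʳ-sum; sum-cong-≗)
open import Data.Fin using (Fin; zero; suc)
open import Data.Product using (_,_)
open import Data.Sum using (inj₁; inj₂)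
open import Data.Empty using (⊥-elim)
open import Function using (_∘_)
open import Relation.Binary.PropositionalEquality
open import Relation.Nullary using (yes; no)

open ≡-Reasoning

fromℚᵘ-homo-+ : ∀ p q → fromℚᵘ (p ℚᵘ.+ q) ≡ fromℚᵘ p + fromℚᵘ q
fromℚᵘ-homo-+ p q = begin
  fromℚᵘ (p ℚᵘ.+ q)
    ≡⟨ fromℚᵘ-cong (ℚᵘ.+-cong (ℚᵘ.≃-sym (toℚᵘ-fromℚᵘ p)) (ℚᵘ.≃-sym (toℚᵘ-fromℚᵘ q))) ⟩
  fromℚᵘ (toℚᵘ (fromℚᵘ p) ℚᵘ.+ toℚᵘ (fromℚᵘ q))
    ≡⟨ fromℚᵘ-cong (ℚᵘ.≃-sym (toℚᵘ-homo-+ (fromℚᵘ p) (fromℚᵘ q))) ⟩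
  fromℚᵘ (toℚᵘ (fromℚᵘ p + fromℚᵘ q))
    ≡⟨ fromℚᵘ-toℚᵘ _ ⟩
  fromℚᵘ p + fromℚᵘ q ∎

fromℚᵘ-homo-* : ∀ p q → fromℚᵘ (p ℚᵘ.* q) ≡ fromℚᵘ p * fromℚᵘ q
fromℚᵘ-homo-* p q = begin
  fromℚᵘ (p ℚᵘ.* q)
    ≡⟨ fromℚᵘ-cong (ℚᵘ.*-cong (ℚᵘ.≃-sym (toℚᵘ-fromℚᵘ p)) (ℚᵘ.≃-sym (toℚᵘ-fromℚᵘ q))) ⟩
  fromℚᵘ (toℚᵘ (fromℚᵘ p) ℚᵘ.* toℚᵘ (fromℚᵘ q))
    ≡⟨ fromℚᵘ-cong (ℚᵘ.≃-sym (toℚᵘ-homo-* (fromℚᵘ p) (fromℚᵘ q))) ⟩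
  fromℚᵘ (toℚᵘ (fromℚᵘ p * fromℚᵘ q))
    ≡⟨ fromℚᵘ-toℚᵘ _ ⟩
  fromℚᵘ p * fromℚᵘ q ∎

-- toℚ z = z / 1 is definitionally fromℚᵘ (mkℚᵘ z 0).
toℚ-homo-+ : ∀ a b → toℚ (a ℤ.+ b) ≡ toℚ a + toℚ b
toℚ-homo-+ a b = begin
  fromℚᵘ (mkℚᵘ (a ℤ.+ b) 0)        ≡⟨ fromℚᵘ-cong sum≃ ⟩
  fromℚᵘ (mkℚᵘ a 0 ℚᵘ.+ mkℚᵘ b 0)  ≡⟨ fromℚᵘ-homo-+ (mkℚᵘ a 0) (mkℚᵘ b 0) ⟩
  toℚ a + toℚ b                    ∎
  where
  sum≃ : mkℚᵘ (a ℤ.+ b) 0 ℚᵘ.≃ mkℚᵘ a 0 ℚᵘ.+ mkℚᵘ b 0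
  sum≃ = *≡* (cong (ℤ._* ℤ.+ 1) (sym (cong₂ ℤ._+_ (ℤ.*-identityʳ a) (ℤ.*-identityʳ b))))

toℚ-homo-* : ∀ a b → toℚ (a ℤ.* b) ≡ toℚ a * toℚ b
toℚ-homo-* a b = fromℚᵘ-homo-* (mkℚᵘ a 0) (mkℚᵘ b 0)

sumℚ≗sum : ∀ {n} (f : Fin n → ℚ) → sumℚ f ≡ sum f
sumℚ≗sum {zero}  f = refl
sumℚ≗sum {suc n} f = cong (f zero +_) (sumℚ≗sum (f ∘ suc))

toℚ-sumℤ : ∀ {n} (f : Fin n → ℤ) → toℚ (sumℤ f) ≡ sum (toℚ ∘ f)
toℚ-sumℤ {zero}  f = refl
toℚ-sumℤ {suc n} f = trans (toℚ-homo-+ (f zero) _) (cong (toℚ (f zero) +_) (toℚ-sumℤ (f ∘ suc)))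

≤∞-trans : ∀ {a b c} → a ≤∞ b → b ≤∞ c → a ≤∞ c
≤∞-trans (fin≤fin p) (fin≤fin q) = fin≤fin (ℕ.≤-trans p q)
≤∞-trans _           ≤∞-top      = ≤∞-top

infixl 9 _∘ᶠ_ _∘ℚ_

_∘ᶠ_ : {d : ℕ} → LinearForm d → LinearMap d d → LinearForm d
(φ ∘ᶠ T) l = sumℤ (λ k → φ k ℤ.* T k l)

_∘ℚ_ : {d : ℕ} → (Fin d → ℚ) → LinearMap d d → (Fin d → ℚ)
(f ∘ℚ T) l = sum (λ k → f k * toℚ (T k l))

module _ {d : ℕ} (T : LinearMap d d) where

  toℚ-∘ᶠ : ∀ (φ : LinearForm d) l → toℚ ((φ ∘ᶠ T) l) ≡ ((toℚ ∘ φ) ∘ℚ T) l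
  toℚ-∘ᶠ φ l = trans (toℚ-sumℤ (λ k → φ k ℤ.* T k l)) (sum-cong-≗ (λ k → toℚ-homo-* (φ k) (T k l)))

  ∘ℚ-cong : ∀ {f g : Fin d → ℚ} → (∀ k → f k ≡ g k) → ∀ l → (f ∘ℚ T) l ≡ (g ∘ℚ T) l
  ∘ℚ-cong f≗g l = sum-cong-≗ (λ k → cong (_* toℚ (T k l)) (f≗g k))

  ∘ℚ-scale : ∀ q (f : Fin d → ℚ) l → ((λ k → q * f k) ∘ℚ T) l ≡ q * (f ∘ℚ T) l
  ∘ℚ-scale q f l = begin
    sum (λ k → q * f k * toℚ (T k l))   ≡⟨ sum-cong-≗ (λ k → *-assoc q (f k) (toℚ (T k l))) ⟩
    sum (λ k → q * (f k * toℚ (T k l))) ≡⟨ *-distribˡ-sum q (λ k → f k * toℚ (T k l)) ⟨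
    q * (f ∘ℚ T) l                      ∎

  ∘ℚ-lincomb : ∀ {t} (c : Fin t → ℚ) (f : Fin t → Fin d → ℚ) l →
    ((λ k → sum (λ j → c j * f j k)) ∘ℚ T) l ≡ sum (λ j → c j * (f j ∘ℚ T) l)
  ∘ℚ-lincomb c f l = begin
    sum (λ k → sum (λ j → c j * f j k) * toℚ (T k l))
      ≡⟨ sum-cong-≗ (λ k → *-distribʳ-sum (toℚ (T k l)) (λ j → c j * f j k)) ⟩
    sum (λ k → sum (λ j → c j * f j k * toℚ (T k l)))
      ≡⟨ ∑-comm (λ k j → c j * f j k * toℚ (T k l)) ⟩
    sum (λ j → ((λ k → c j * f j k) ∘ℚ T) l)
      ≡⟨ sum-cong-≗ (λ j → ∘ℚ-scale (c j) (f j) l) ⟩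
    sum (λ j → c j * (f j ∘ℚ T) l) ∎

  RatMultiple-∘ᶠ : ∀ (ψ φ : LinearForm d) → RatMultiple ψ φ → RatMultiple (ψ ∘ᶠ T) (φ ∘ᶠ T)
  RatMultiple-∘ᶠ ψ φ (q , ψ≡qφ) = q , λ l → begin
    toℚ ((ψ ∘ᶠ T) l)                   ≡⟨ toℚ-∘ᶠ ψ l ⟩
    ((toℚ ∘ ψ) ∘ℚ T) l                 ≡⟨ ∘ℚ-cong ψ≡qφ l ⟩
    ((λ k → q * toℚ (φ k)) ∘ℚ T) l     ≡⟨ ∘ℚ-scale q (toℚ ∘ φ) l ⟩
    q * ((toℚ ∘ φ) ∘ℚ T) l             ≡⟨ cong (q *_) (toℚ-∘ᶠ φ l) ⟨
    q * toℚ ((φ ∘ᶠ T) l)               ∎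

  InSpan-∘ₗ : ∀ {t} (Ψ : LinearMap d t) (P : Fin t → Set) (φ : LinearForm d) →
    InSpan Ψ P φ → InSpan (Ψ ∘ₗ T) P (φ ∘ᶠ T)
  InSpan-∘ₗ Ψ P φ (c , c-supp , φ≡∑cΨ) = c , c-supp , λ l → begin
    toℚ ((φ ∘ᶠ T) l)
      ≡⟨ toℚ-∘ᶠ φ l ⟩
    ((toℚ ∘ φ) ∘ℚ T) l
      ≡⟨ ∘ℚ-cong (λ k → trans (φ≡∑cΨ k) (sumℚ≗sum (λ j → c j * toℚ (Ψ j k)))) l ⟩
    ((λ k → sum (λ j → c j * toℚ (Ψ j k))) ∘ℚ T) l
      ≡⟨ ∘ℚ-lincomb c (λ j → toℚ ∘ Ψ j) l ⟩
    sum (λ j → c j * ((toℚ ∘ Ψ j) ∘ℚ T) l)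
      ≡⟨ sum-cong-≗ (λ j → cong (c j *_) (toℚ-∘ᶠ (Ψ j) l)) ⟨
    sum (λ j → c j * toℚ ((Ψ ∘ₗ T) j l))
      ≡⟨ sumℚ≗sum (λ j → c j * toℚ ((Ψ ∘ₗ T) j l)) ⟨
    sumℚ (λ j → c j * toℚ ((Ψ ∘ₗ T) j l)) ∎

  HasMultipleAt-∘ₗ : ∀ {t} (Ψ : LinearMap d t) i → HasMultipleAt Ψ i → HasMultipleAt (Ψ ∘ₗ T) i
  HasMultipleAt-∘ₗ Ψ i (j , j≢i , ψᵢ≡qψⱼ) = j , j≢i , RatMultiple-∘ᶠ (Ψ i) (Ψ j) ψᵢ≡qψⱼ

  GTPartition-∘ₗ⁻ : ∀ {t} (Ψ : LinearMap d t) i {s} → GTPartition (Ψ ∘ₗ T) i s → GTPartition Ψ i s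
  GTPartition-∘ₗ⁻ Ψ i (cls , avoids) = cls , λ a inSpan → avoids a (InSpan-∘ₗ Ψ _ (Ψ i) inSpan)

module _ {d e t : ℕ} {Ψ : LinearMap d t} {Φ : LinearMap e t} where

  IsIComplexity-mono : ∀ {i} →
    (HasMultipleAt Ψ i → HasMultipleAt Φ i) → (∀ {s} → GTPartition Φ i s → GTPartition Ψ i s) →
    ∀ {a b} → IsIComplexity Ψ i a → IsIComplexity Φ i b → a ≤∞ b
  IsIComplexity-mono _     _     {b = ∞}         _    _             = ≤∞-top
  IsIComplexity-mono mult⇒ _     {∞}     {fin _} mult (noMult , _) = ⊥-elim (noMult (mult⇒ mult))
  IsIComplexity-mono _     part⇐ {fin r} {fin s} (_ , _ , r-least) (_ , partition , _)
    with r ℕ.≤? s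
  ... | yes r≤s = fin≤fin r≤s
  ... | no  r≰s = ⊥-elim (r-least s (ℕ.≰⇒> r≰s) (part⇐ partition))

  IsGTComplexity-mono : (∀ i {a b} → IsIComplexity Ψ i a → IsIComplexity Φ i b → a ≤∞ b) →
    ∀ {c c'} → IsGTComplexity Ψ c → IsGTComplexity Φ c' → c ≤∞ c'
  IsGTComplexity-mono _ {c' = fin _} (_ , inj₁ refl) _ = fin≤fin ℕ.z≤n
  IsGTComplexity-mono _ {c' = ∞}     (_ , inj₁ refl) _ = ≤∞-top
  IsGTComplexity-mono iMono (_ , inj₂ (i , cIsAt)) (bounded , _) =
    let (cᵢ , cᵢIsAt , cᵢ≤c') = bounded i in ≤∞-trans (iMono i cIsAt cᵢIsAt) cᵢ≤c'

mainTheorem5 : (d t : ℕ) (T : LinearMap d d) (Ψ : LinearMap d t)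
    → (c c' : ℕ∞) → IsGTComplexity Ψ c → IsGTComplexity (Ψ ∘ₗ T) c' → c ≤∞ c'
mainTheorem5 _ _ T Ψ _ _ =
  IsGTComplexity-mono (λ i → IsIComplexity-mono (HasMultipleAt-∘ₗ T Ψ i) (GTPartition-∘ₗ⁻ T Ψ i))
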